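{- The class $\mathbb{RL}^B$ is an equational class (a variety). More precisely, an algebra $\mathbf{A}=(A;\wedge,\vee,\cdot,\to,B,0,1)$ whose reduct $(A;\wedge,\vee,\cdot,\to,0,1)$ is a residuated lattice belongs to $\mathbb{RL}^B$ if and only if it satisfies the following equations, where $x\preccurlyeq y$ abbreviates $x\vee y\approx y$ and $\neg x$ abbreviates $x\to 0$: (BE1) $Bx\preccurlyeq x$; (BE2) $Bx\vee\neg Bx\approx 1$; (BI1) $Bx\preccurlyeq B(x\vee y)$; (BI2) $B1\approx 1$; (BI3) $B(x\vee\neg x)\preccurlyeq Bx\vee\neg x$. That is, these five equations together with the equations axiomatizing residuated lattices form an equational basis of $\mathbb{RL}^B$.
   Context: A residuated lattice (bounded, integral, commutative) is an algebra $(A;\wedge,\vee,\cdot,\to,0,1)$ such that $(A;\wedge,\vee,0,1)$ is a bounded lattice with least element $0$ and greatest element $1$, $(A;\cdot,1)$ is a commutative monoid, and $a\cdot b\le c$ iff $a\le b\to c$ for all $a,b,c$. Write $\neg a=a\to 0$. An element $a$ is Boolean if there is $b$ with $a\wedge b=0$ and $a\vee b=1$ (equivalently $a\vee\neg a=1$). $\mathbb{RL}^B$ is the class of algebras $(A;\wedge,\vee,\cdot,\to,B,0,1)$ whose reduct is a residuated lattice and where $B$ is a unary operation such that for all $a,b\in A$: $Ba\le a$; $Ba\vee\neg Ba=1$; and if $b\le a$ and $b\vee\neg b=1$ then $b\le Ba$ (i.e. $Ba$ is the greatest Boolean element below $a$). -}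

module Defs where

open import Level using (Level; suc)
open import Relation.Binary.PropositionalEquality using (_≡_)
open import Data.Product using (_×_)

-- Bounded, integral, commutative residuated lattice, with equality taken to be
-- propositional equality on the carrier.  The lattice is given equationally;
-- the order is  x ≤ y  :=  x ∨ y ≡ y.
record ResiduatedLattice (a : Level) : Set (suc a) where
  infixr 6 _∨_
  infixr 7 _∧_
  infixr 8 _·_
  infixr 5 _⇒_
  infix 4 _≤_
  field
    Carrier : Set a
    _∧_ _∨_ _·_ _⇒_ : Carrier → Carrier → Carrier
    𝟘 𝟙 : Carrier
    ∨-comm   : ∀ x y → x ∨ y ≡ y ∨ x
    ∧-comm   : ∀ x y → x ∧ y ≡ y ∧ x
    ∨-assoc  : ∀ x y z → (x ∨ y) ∨ z ≡ x ∨ (y ∨ z)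
    ∧-assoc  : ∀ x y z → (x ∧ y) ∧ z ≡ x ∧ (y ∧ z)
    ∨-absorbs-∧ : ∀ x y → x ∨ (x ∧ y) ≡ x
    ∧-absorbs-∨ : ∀ x y → x ∧ (x ∨ y) ≡ x
    𝟘-least    : ∀ x → 𝟘 ∨ x ≡ x
    𝟙-greatest : ∀ x → x ∨ 𝟙 ≡ 𝟙
    ·-comm   : ∀ x y → x · y ≡ y · x
    ·-assoc  : ∀ x y z → (x · y) · z ≡ x · (y · z)
    ·-identityʳ : ∀ x → x · 𝟙 ≡ x

  _≤_ : Carrier → Carrier → Set a
  x ≤ y = x ∨ y ≡ y

  field
    residuated₁ : ∀ x y z → x · y ≤ z → x ≤ y ⇒ z
    residuated₂ : ∀ x y z → x ≤ y ⇒ z → x · y ≤ z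

  ¬_ : Carrier → Carrier
  ¬ x = x ⇒ 𝟘

-- The defining (quasi-)conditions of RL^B for an operation B on a residuated lattice:
-- B x is the greatest Boolean element below x.
IsRLB : ∀ {a} (R : ResiduatedLattice a) → (ResiduatedLattice.Carrier R → ResiduatedLattice.Carrier R) → Set a
IsRLB R B =
    (∀ x → B x ≤ x)
  × (∀ x → B x ∨ (¬ B x) ≡ 𝟙)
  × (∀ x y → y ≤ x → y ∨ (¬ y) ≡ 𝟙 → y ≤ B x)
  where open ResiduatedLattice R

SatisfiesBEqs : ∀ {a} (R : ResiduatedLattice a) → (ResiduatedLattice.Carrier R → ResiduatedLattice.Carrier R) → Set a
SatisfiesBEqs R B =
    (∀ x → B x ∨ x ≡ x)
  × (∀ x → B x ∨ (¬ B x) ≡ 𝟙)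
  × (∀ x y → B x ∨ B (x ∨ y) ≡ B (x ∨ y))
  × (B 𝟙 ≡ 𝟙)
  × (∀ x → B (x ∨ (¬ x)) ∨ (B x ∨ (¬ x)) ≡ B x ∨ (¬ x))
  where open ResiduatedLattice R

-- B is monotone (BI1) and fixes 𝟙 (BI2), so for a Boolean y we get
-- 𝟙 = B (y ∨ ¬ y) ≤ B y ∨ ¬ y by (BI3), and in a residuated lattice
-- c ∨ ¬ y = 𝟙 already forces y ≤ c; hence every Boolean element below x lies
-- below B x.  Conversely, if b = B (x ∨ ¬ x) then b splits as x · b ∨ ¬ x · b,
-- and x · b is a Boolean element below x, hence below B x.
module Submission where

open import Defs
open import Level using (Level)
open import Data.Product using (_×_; _,_)
open import Relation.Binary.Bundles using (Poset)
open import Relation.Binary.PropositionalEquality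
  using (_≡_; refl; sym; trans; cong; subst; isEquivalence)

module ResiduatedLatticeProperties {a : Level} (R : ResiduatedLattice a) where
  open ResiduatedLattice R

  ∨-idem : ∀ x → x ∨ x ≡ x
  ∨-idem x = trans (cong (x ∨_) (sym (∧-absorbs-∨ x x))) (∨-absorbs-∧ x (x ∨ x))

  ≤-reflexive : ∀ {x y} → x ≡ y → x ≤ y
  ≤-reflexive {x} refl = ∨-idem x

  ≤-trans : ∀ {x y z} → x ≤ y → y ≤ z → x ≤ z
  ≤-trans {x} {y} {z} x≤y y≤z =
    trans (cong (x ∨_) (sym y≤z))
      (trans (sym (∨-assoc x y z)) (trans (cong (_∨ z) x≤y) y≤z))

  ≤-antisym : ∀ {x y} → x ≤ y → y ≤ x → x ≡ y
  ≤-antisym {x} {y} x≤y y≤x = trans (sym y≤x) (trans (∨-comm y x) x≤y)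

  ≤-poset : Poset a a a
  ≤-poset = record
    { isPartialOrder = record
      { isPreorder = record
        { isEquivalence = isEquivalence
        ; reflexive     = ≤-reflexive
        ; trans         = ≤-trans
        }
      ; antisym = ≤-antisym
      }
    }

  open import Relation.Binary.Reasoning.PartialOrder ≤-poset

  ≤-refl : ∀ {x} → x ≤ x
  ≤-refl = ≤-reflexive refl

  x≤x∨y : ∀ x y → x ≤ x ∨ y
  x≤x∨y x y = trans (sym (∨-assoc x x y)) (cong (_∨ y) (∨-idem x))

  y≤x∨y : ∀ x y → y ≤ x ∨ y
  y≤x∨y x y = ≤-trans (x≤x∨y y x) (≤-reflexive (∨-comm y x))

  ∨-lub : ∀ {x y z} → x ≤ z → y ≤ z → x ∨ y ≤ z
  ∨-lub {x} {y} {z} x≤z y≤z = trans (∨-assoc x y z) (trans (cong (x ∨_) y≤z) x≤z)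

  ∨-mono-≤ : ∀ {x y u v} → x ≤ u → y ≤ v → x ∨ y ≤ u ∨ v
  ∨-mono-≤ {u = u} {v} x≤u y≤v =
    ∨-lub (≤-trans x≤u (x≤x∨y u v)) (≤-trans y≤v (y≤x∨y u v))

  ≤𝟙 : ∀ {x} → x ≤ 𝟙
  ≤𝟙 {x} = 𝟙-greatest x

  𝟙≤⇒≡𝟙 : ∀ {x} → 𝟙 ≤ x → x ≡ 𝟙
  𝟙≤⇒≡𝟙 𝟙≤x = ≤-antisym ≤𝟙 𝟙≤x

  ·-monoˡ-≤ : ∀ {x y} z → x ≤ y → x · z ≤ y · z
  ·-monoˡ-≤ {x} {y} z x≤y =
    residuated₂ x z (y · z) (≤-trans x≤y (residuated₁ y z (y · z) ≤-refl))

  ·-monoʳ-≤ : ∀ z {x y} → x ≤ y → z · x ≤ z · y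
  ·-monoʳ-≤ z {x} {y} x≤y = begin
    z · x  ≡⟨ ·-comm z x ⟩
    x · z  ≤⟨ ·-monoˡ-≤ z x≤y ⟩
    y · z  ≡⟨ ·-comm y z ⟩
    z · y  ∎

  ·-distribʳ-∨-≤ : ∀ x y z → (x ∨ y) · z ≤ x · z ∨ y · z
  ·-distribʳ-∨-≤ x y z = residuated₂ (x ∨ y) z _
    (∨-lub (residuated₁ x z _ (x≤x∨y _ _)) (residuated₁ y z _ (y≤x∨y _ _)))

  x·y≤x : ∀ x y → x · y ≤ x
  x·y≤x x y = ≤-trans (·-monoʳ-≤ x ≤𝟙) (≤-reflexive (·-identityʳ x))

  x·y≤y : ∀ x y → x · y ≤ y
  x·y≤y x y = ≤-trans (≤-reflexive (·-comm x y)) (x·y≤x y x)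

  x·¬x≤𝟘 : ∀ x → x · ¬ x ≤ 𝟘
  x·¬x≤𝟘 x = ≤-trans (≤-reflexive (·-comm x (¬ x))) (residuated₂ (¬ x) x 𝟘 ≤-refl)

  ¬-antitone : ∀ {x y} → x ≤ y → ¬ y ≤ ¬ x
  ¬-antitone {x} {y} x≤y = residuated₁ (¬ y) x 𝟘 (begin
    ¬ y · x  ≤⟨ ·-monoʳ-≤ (¬ y) x≤y ⟩
    ¬ y · y  ≡⟨ ·-comm (¬ y) y ⟩
    y · ¬ y  ≤⟨ x·¬x≤𝟘 y ⟩
    𝟘        ∎)

  c∨¬x≡𝟙⇒x≤x·c : ∀ {x c} → c ∨ ¬ x ≡ 𝟙 → x ≤ x · c
  c∨¬x≡𝟙⇒x≤x·c {x} {c} c∨¬x≡𝟙 = begin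
    x                  ≡⟨ sym (·-identityʳ x) ⟩
    x · 𝟙              ≡⟨ cong (x ·_) (sym c∨¬x≡𝟙) ⟩
    x · (c ∨ ¬ x)      ≡⟨ ·-comm x _ ⟩
    (c ∨ ¬ x) · x      ≤⟨ ·-distribʳ-∨-≤ c (¬ x) x ⟩
    c · x ∨ ¬ x · x    ≤⟨ ∨-lub (≤-reflexive (·-comm c x)) x·¬x≤x·c ⟩
    x · c              ∎
    where
    x·¬x≤x·c : ¬ x · x ≤ x · c
    x·¬x≤x·c = ≤-trans (≤-reflexive (·-comm (¬ x) x))
                 (≤-trans (x·¬x≤𝟘 x) (𝟘-least (x · c)))

  c∨¬x≡𝟙⇒x≤c : ∀ {x c} → c ∨ ¬ x ≡ 𝟙 → x ≤ c
  c∨¬x≡𝟙⇒x≤c {x} {c} c∨¬x≡𝟙 = ≤-trans (c∨¬x≡𝟙⇒x≤x·c c∨¬x≡𝟙) (x·y≤y x c)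

  IsBoolean : Carrier → Set a
  IsBoolean b = b ∨ ¬ b ≡ 𝟙

  𝟙-isBoolean : IsBoolean 𝟙
  𝟙-isBoolean = trans (∨-comm 𝟙 (¬ 𝟙)) (𝟙-greatest (¬ 𝟙))

  boolean-split : ∀ {b} x y → IsBoolean b → b ≤ x ∨ y → b ≤ x · b ∨ y · b
  boolean-split {b} x y b-bool b≤x∨y = begin
    b              ≤⟨ c∨¬x≡𝟙⇒x≤x·c b-bool ⟩
    b · b          ≤⟨ ·-monoˡ-≤ b b≤x∨y ⟩
    (x ∨ y) · b    ≤⟨ ·-distribʳ-∨-≤ x y b ⟩
    x · b ∨ y · b  ∎

  ·-isBoolean : ∀ {b} x → IsBoolean b → b ≤ x ∨ ¬ x → IsBoolean (x · b)
  ·-isBoolean {b} x b-bool b≤x∨¬x = 𝟙≤⇒≡𝟙 (begin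
    𝟙                           ≡⟨ sym b-bool ⟩
    b ∨ ¬ b                     ≤⟨ ∨-mono-≤ (boolean-split x (¬ x) b-bool b≤x∨¬x) ≤-refl ⟩
    (x · b ∨ ¬ x · b) ∨ ¬ b     ≡⟨ ∨-assoc _ _ _ ⟩
    x · b ∨ (¬ x · b ∨ ¬ b)     ≤⟨ ∨-mono-≤ ≤-refl (∨-lub ¬x·b≤¬[x·b] ¬b≤¬[x·b]) ⟩
    x · b ∨ ¬ (x · b)           ∎)
    where
    ¬x·b≤¬[x·b] : ¬ x · b ≤ ¬ (x · b)
    ¬x·b≤¬[x·b] = ≤-trans (x·y≤x (¬ x) b) (¬-antitone (x·y≤x x b))
    ¬b≤¬[x·b] : ¬ b ≤ ¬ (x · b)
    ¬b≤¬[x·b] = ¬-antitone (x·y≤y x b)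

  isRLB⇒satisfiesBEqs : (B : Carrier → Carrier) → IsRLB R B → SatisfiesBEqs R B
  isRLB⇒satisfiesBEqs B (Bx≤x , Bx-bool , B-greatest) = Bx≤x , Bx-bool , BI1 , BI2 , BI3
    where
    BI1 : ∀ x y → B x ≤ B (x ∨ y)
    BI1 x y = B-greatest (x ∨ y) (B x) (≤-trans (Bx≤x x) (x≤x∨y x y)) (Bx-bool x)

    BI2 : B 𝟙 ≡ 𝟙
    BI2 = 𝟙≤⇒≡𝟙 (B-greatest 𝟙 𝟙 ≤-refl 𝟙-isBoolean)

    BI3 : ∀ x → B (x ∨ ¬ x) ≤ B x ∨ ¬ x
    BI3 x = begin
      b                  ≤⟨ boolean-split x (¬ x) (Bx-bool _) (Bx≤x _) ⟩
      x · b ∨ ¬ x · b    ≤⟨ ∨-mono-≤ x·b≤Bx (x·y≤x (¬ x) b) ⟩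
      B x ∨ ¬ x          ∎
      where
      b = B (x ∨ ¬ x)
      x·b≤Bx : x · b ≤ B x
      x·b≤Bx = B-greatest x (x · b) (x·y≤x x b) (·-isBoolean x (Bx-bool _) (Bx≤x _))

  satisfiesBEqs⇒isRLB : (B : Carrier → Carrier) → SatisfiesBEqs R B → IsRLB R B
  satisfiesBEqs⇒isRLB B (BE1 , BE2 , BI1 , BI2 , BI3) = BE1 , BE2 , B-greatest
    where
    B-greatest : ∀ x y → y ≤ x → IsBoolean y → y ≤ B x
    B-greatest x y y≤x y-bool = begin
      y        ≤⟨ c∨¬x≡𝟙⇒x≤c (𝟙≤⇒≡𝟙 𝟙≤By∨¬y) ⟩
      B y      ≤⟨ subst (λ t → B y ≤ B t) y≤x (BI1 y x) ⟩
      B x      ∎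
      where
      𝟙≤By∨¬y : 𝟙 ≤ B y ∨ ¬ y
      𝟙≤By∨¬y = begin
        𝟙              ≡⟨ sym BI2 ⟩
        B 𝟙            ≡⟨ cong B (sym y-bool) ⟩
        B (y ∨ ¬ y)    ≤⟨ BI3 y ⟩
        B y ∨ ¬ y      ∎

theorem1 : ∀ {a : Level} (R : ResiduatedLattice a)
             (B : ResiduatedLattice.Carrier R → ResiduatedLattice.Carrier R) →
             (IsRLB R B → SatisfiesBEqs R B) × (SatisfiesBEqs R B → IsRLB R B)
theorem1 R B = isRLB⇒satisfiesBEqs B , satisfiesBEqs⇒isRLB B
  where open ResiduatedLatticeProperties R
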